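{- Let $N\ge1$ be an integer and $\chi$ a Dirichlet character of conductor $f$. For $n\ge 1$, \[ B_{N,n,\chi}=\sum_{k=0}^n\frac{k!}{f^{N-k}}\binom{n}{k}\sum_{r=0}^k\binom{k+1}{r+1}\widetilde{T}_r(k)\, S_{n-k}, \qquad B_{N,n,\chi}(x)=\sum_{k=0}^n\frac{k!}{f^{N-k}}\binom{n}{k}\sum_{r=0}^k\binom{k+1}{r+1}\widetilde{T}_r(k)\, S_{n-k}(x), \] where \[ \widetilde{T}_r(k):=(-N!)^r\sum_{\substack{i_1+\cdots+i_r=k\\ i_1,\dots,i_r\ge 0}}\frac{1}{(N+i_1)!\cdots(N+i_r)!} \] with $\widetilde{T}_0(0)=1$ and $\widetilde{T}_0(k)=0$ for $k\ge 1$.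
   Context: For an integer $N\ge 1$ and a Dirichlet character $\chi$ of conductor $f$, the generalized hypergeometric Bernoulli numbers $B_{N,n,\chi}$ and polynomials $B_{N,n,\chi}(x)$ are defined by $\sum_{a=1}^f \frac{\chi(a)\, t^N e^{at}/N!}{e^{ft}-\sum_{m=0}^{N-1}\frac{(ft)^m}{m!}}=\sum_{n=0}^\infty B_{N,n,\chi}\frac{t^n}{n!}$ and $\sum_{a=1}^f \frac{\chi(a)\, t^N e^{(x+a)t}/N!}{e^{ft}-\sum_{m=0}^{N-1}\frac{(ft)^m}{m!}}=\sum_{n=0}^\infty B_{N,n,\chi}(x)\frac{t^n}{n!}$ for $|t|<2\pi/f$. Put $S_n:=\sum_{a=1}^f\chi(a)a^n$ and $S_n(x):=\sum_{a=1}^f\chi(a)(x+a)^n$. -}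

module Defs where

open import Level using (Level)
open import Data.Nat as ℕ using (ℕ; zero; suc; _∸_; _<ᵇ_; NonZero; _!)
open import Data.Nat.Divisibility using (_∣_)
open import Data.Nat.Properties using (m^n≢0; _!≢0)
open import Data.Nat.Combinatorics using (_C_)
open import Data.Nat.GCD using (gcd)
open import Data.Nat.Coprimality using (Coprime)
open import Data.Integer using (+_)
open import Data.Rational as ℚ using (ℚ; 0ℚ; 1ℚ)
open import Data.Rational.Properties using (+-*-commutativeRing)
open import Data.Bool using (if_then_else_)
open import Data.List using (List; []; _∷_; _++_; [_])
open import Data.Product using (∃)
open import Relation.Binary.PropositionalEquality using (_≡_; _≢_)
open import Relation.Nullary using (¬_)
open import Algebra.Bundles using (CommutativeRing)

ℕ→ℚ : ℕ → ℚ
ℕ→ℚ m = (+ m) ℚ./ 1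

inv! : ℕ → ℚ
inv! m = ℚ._/_ (+ 1) (m !) {{m !≢0}}

powℚ : ℚ → ℕ → ℚ
powℚ x zero    = 1ℚ
powℚ x (suc m) = x ℚ.* powℚ x m

sumℚ≤ : ℕ → (ℕ → ℚ) → ℚ
sumℚ≤ zero    g = g 0
sumℚ≤ (suc n) g = sumℚ≤ n g ℚ.+ g (suc n)

-- Ttilde_r(k) = (-N!)^r Σ_{i_1+…+i_r=k, i_j ≥ 0} 1/((N+i_1)! ⋯ (N+i_r)!)
-- The sum over compositions W N r k is written as an iterated sum,
-- peeling off the first index i_1 = i.  W N 0 0 = 1, W N 0 (k+1) = 0
-- (the empty composition), which gives Ttilde_0(0)=1, Ttilde_0(k)=0 (k≥1).

W : (N r k : ℕ) → ℚ
W N zero    zero    = 1ℚ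
W N zero    (suc k) = 0ℚ
W N (suc r) k       = sumℚ≤ k (λ i → inv! (N ℕ.+ i) ℚ.* W N r (k ∸ i))

Ttilde : (N r k : ℕ) → ℚ
Ttilde N r k = powℚ (ℚ.- ℕ→ℚ (N !)) r ℚ.* W N r k

-- The ring ℚ, used to express that ι : ℚ → R is a ring homomorphism
-- (i.e. R is a ℚ-algebra, e.g. ℂ).

ℚring : CommutativeRing _ _
ℚring = +-*-commutativeRing

module Over {c ℓ : Level} (R : CommutativeRing c ℓ)
            (ι : ℚ → CommutativeRing.Carrier R) where

  open CommutativeRing R

  ⟨_⟩ : ℕ → Carrier
  ⟨ a ⟩ = ι (ℕ→ℚ a)

  pow : Carrier → ℕ → Carrier
  pow y zero    = 1#
  pow y (suc m) = y * pow y m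

  sum≤ : ℕ → (ℕ → Carrier) → Carrier
  sum≤ zero    g = g 0
  sum≤ (suc n) g = sum≤ n g + g (suc n)

  sum1 : ℕ → (ℕ → Carrier) → Carrier
  sum1 zero    g = 0#
  sum1 (suc f) g = sum1 f g + g (suc f)

  record IsDirichletCharacter (f : ℕ) (χ : ℕ → Carrier) : Set (c Level.⊔ ℓ) where
    field
      periodic       : ∀ a → χ (a ℕ.+ f) ≈ χ a
      multiplicative : ∀ a b → χ (a ℕ.* b) ≈ χ a * χ b
      one            : χ 1 ≈ 1#
      vanish         : ∀ a → gcd a f ≢ 1 → χ a ≈ 0#
      unit           : ∀ a → gcd a f ≡ 1 → ∃ λ y → χ a * y ≈ 1#

  -- χ is primitive modulo f: it is not induced from any modulus d ∣ f, d < f,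
  -- i.e. for every such d there is a ≡ 1 (mod d), (a,f)=1, with χ(a) ≠ 1.
  record HasConductor (f : ℕ) (χ : ℕ → Carrier) : Set (c Level.⊔ ℓ) where
    field
      isCharacter : IsDirichletCharacter f χ
      isPrimitive : ∀ d → d ∣ f → d ℕ.< f →
                    ¬ (∀ a m → Coprime a f → a ≡ 1 ℕ.+ m ℕ.* d → χ a ≈ 1#)

  S : (f : ℕ) → (χ : ℕ → Carrier) → ℕ → Carrier
  S f χ n = sum1 f (λ a → χ a * pow ⟨ a ⟩ n)

  Sx : (f : ℕ) → (χ : ℕ → Carrier) → Carrier → ℕ → Carrier
  Sx f χ x n = sum1 f (λ a → χ a * pow (x + ⟨ a ⟩) n)

  -- Generating function, as a formal power series quotient.
  -- base a = a (for B_{N,n,χ}) or x + a (for B_{N,n,χ}(x)).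
  --
  -- Numerator  Σ_{a=1}^f χ(a) t^N e^{base(a) t} / N!  has t^m-coefficient
  --   num m = [m ≥ N] Σ_a χ(a) (1/N!) base(a)^{m-N} / (m-N)!.
  -- Denominator  e^{ft} - Σ_{m=0}^{N-1} (ft)^m/m!  has t^j-coefficient
  --   den j = f^j/j! - [j < N] f^j/j!   (so den j = 0 for j < N, den N = f^N/N!).
  -- The quotient Q = Σ q_n t^n is the unique series with Q·den = num, i.e.
  --   Σ_{i=0}^{n} q_i den(N+n-i) = num(N+n),
  -- solved recursively: q_n = (N!/f^N) (num(N+n) - Σ_{i<n} q_i den(N+n-i)).

  module GF (N f : ℕ) .{{_ : NonZero f}} (χ : ℕ → Carrier) (base : ℕ → Carrier) where

    num : ℕ → Carrier
    num m = if m ℕ.<ᵇ N then 0#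
            else sum1 f (λ a → χ a * (ι (inv! N) * (ι (inv! (m ∸ N)) * pow (base a) (m ∸ N))))

    den : ℕ → ℚ
    den j = (ℕ→ℚ (f ℕ.^ j) ℚ.* inv! j) ℚ.- (if j ℕ.<ᵇ N then ℕ→ℚ (f ℕ.^ j) ℚ.* inv! j else 0ℚ)

    -- 1 / den N = N! / f^N
    invLead : ℚ
    invLead = ℚ._/_ (+ (N !)) (f ℕ.^ N) {{m^n≢0 f N}}

    conv : (n i : ℕ) → List Carrier → Carrier
    conv n i []       = 0#
    conv n i (q ∷ qs) = ι (den (N ℕ.+ n ∸ i)) * q + conv n (suc i) qs

    step : ℕ → List Carrier → Carrier
    step n qs = ι invLead * (num (N ℕ.+ n) - conv n 0 qs)

    prefix : ℕ → List Carrier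
    prefix zero    = []
    prefix (suc n) = prefix n ++ [ step n (prefix n) ]

    coeff : ℕ → Carrier
    coeff n = step n (prefix n)

  B : (N f : ℕ) .{{_ : NonZero f}} (χ : ℕ → Carrier) → ℕ → Carrier
  B N f χ n = ⟨ n ! ⟩ * GF.coeff N f χ (λ a → ⟨ a ⟩) n

  Bx : (N f : ℕ) .{{_ : NonZero f}} (χ : ℕ → Carrier) → Carrier → ℕ → Carrier
  Bx N f χ x n = ⟨ n ! ⟩ * GF.coeff N f χ (λ a → x + ⟨ a ⟩) n

  -- Right-hand side:  Σ_{k=0}^n k!/f^{N-k} C(n,k) Σ_{r=0}^k C(k+1,r+1) T̃_r(k) · s(n-k)
  -- where f^{N-k} is read in ℚ as f^k / f^N (k may exceed N).

  coefRHS : (N f : ℕ) .{{_ : NonZero f}} (n k : ℕ) → ℚ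
  coefRHS N f n k =
    (ℚ._/_ (+ (k ! ℕ.* f ℕ.^ k)) (f ℕ.^ N) {{m^n≢0 f N}})
    ℚ.* (ℕ→ℚ (n C k)
    ℚ.* sumℚ≤ k (λ r → ℕ→ℚ (suc k C suc r) ℚ.* Ttilde N r k))

  RHS : (N f : ℕ) .{{_ : NonZero f}} (s : ℕ → Carrier) → ℕ → Carrier
  RHS N f s n = sum≤ n (λ k → ι (coefRHS N f n k) * s (n ∸ k))

-- Write the denominator as e^{ft} − Σ_{m<N} (ft)^m/m! = (f^N/N!) t^N D(ft), where
-- D(t) = Σ_j N! t^j/(N+j)!, and put g := −D. Then g has constant term −1 and
-- [t^k] g^r = T̃_r(k). As h := 1 + g has no constant term, 1/D = 1/(1 − h) agrees with
-- Σ_{m≤k} h^m up to degree k; expanding h^m = (1 + g)^m binomially and summing with the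
-- hockey-stick identity Σ_{r≤m≤k} C(m,r) = C(k+1,r+1) gives [t^k] 1/D = Σ_r C(k+1,r+1) T̃_r(k).
-- Multiplying by the numerator (t^N/N!) Σ_n S_n t^n/n! and comparing coefficients yields the
-- formula, for S_n and S_n(x) alike; the recursively defined coefficients of the generating
-- function agree with this product because both solve the same triangular system.

module Submission where

open import Defs
open import Level using (Level)
open import Function using (_∘_)
open import Data.Bool using (false; if_then_else_)
open import Data.Nat as ℕ using (ℕ; zero; suc; _∸_; _≥_; _<ᵇ_; z≤n; s≤s; NonZero; _!)
import Data.Nat.Properties as ℕₚ
open import Data.Nat.Properties using (_!≢0; _!*_!≢0; m^n≢0)
open import Data.Nat.Combinatorics
  using (_C_; nCk+nC[k+1]≡[n+1]C[k+1]; k>n⇒nCk≡0; nCk≡n!/k![n-k]!; k![n∸k]!∣n!)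
open import Data.Nat.DivMod using (m/n*n≡m)
open import Data.Nat.Induction using (<-rec)
open import Data.Integer as ℤ using (+_)
import Data.Integer.Properties as ℤₚ
open import Data.Rational as ℚ using (ℚ; 0ℚ; 1ℚ)
import Data.Rational.Properties as ℚₚ
import Data.Rational.Unnormalised as ℚᵘ
import Data.Rational.Unnormalised.Properties as ℚᵘₚ
open import Data.List using ([]; _∷_; _++_; [_]; length)
open import Data.List.Properties using (length-++)
open import Relation.Binary.PropositionalEquality as ≡ using (_≡_)
open import Algebra.Bundles using (CommutativeRing)
open import Algebra.Morphism.Structures using (IsRingHomomorphism)

1/ℕ : (q : ℕ) .{{_ : NonZero q}} → ℚ
1/ℕ q = (+ 1) ℚ./ q

toℚᵘ-ℕ/ : ∀ p d → ℚ.toℚᵘ ((+ p) ℚ./ suc d) ℚᵘ.≃ ℚᵘ.mkℚᵘ (+ p) d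
toℚᵘ-ℕ/ p d = ℚₚ.toℚᵘ-fromℚᵘ (ℚᵘ.mkℚᵘ (+ p) d)

ℕ→ℚ-homo-+ : ∀ m n → ℕ→ℚ (m ℕ.+ n) ≡ ℕ→ℚ m ℚ.+ ℕ→ℚ n
ℕ→ℚ-homo-+ m n = ℚₚ.toℚᵘ-injective (begin
  ℚ.toℚᵘ (ℕ→ℚ (m ℕ.+ n))
    ≈⟨ toℚᵘ-ℕ/ (m ℕ.+ n) 0 ⟩
  ℚᵘ.mkℚᵘ (+ (m ℕ.+ n)) 0
    ≈⟨ ℚᵘ.*≡* (≡.cong (ℤ._* + 1) (≡.trans (ℤₚ.pos-+ m n)
         (≡.sym (≡.cong₂ ℤ._+_ (ℤₚ.*-identityʳ (+ m)) (ℤₚ.*-identityʳ (+ n)))))) ⟩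
  ℚᵘ.mkℚᵘ (+ m) 0 ℚᵘ.+ ℚᵘ.mkℚᵘ (+ n) 0
    ≈⟨ ℚᵘₚ.+-cong (toℚᵘ-ℕ/ m 0) (toℚᵘ-ℕ/ n 0) ⟨
  ℚ.toℚᵘ (ℕ→ℚ m) ℚᵘ.+ ℚ.toℚᵘ (ℕ→ℚ n)
    ≈⟨ ℚₚ.toℚᵘ-homo-+ (ℕ→ℚ m) (ℕ→ℚ n) ⟨
  ℚ.toℚᵘ (ℕ→ℚ m ℚ.+ ℕ→ℚ n) ∎)
  where open ℚᵘₚ.≃-Reasoning

p/q≡p*1/q : ∀ p q .{{_ : NonZero q}} → (+ p) ℚ./ q ≡ ℕ→ℚ p ℚ.* 1/ℕ q
p/q≡p*1/q p (suc d) = ℚₚ.toℚᵘ-injective (begin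
  ℚ.toℚᵘ ((+ p) ℚ./ suc d)
    ≈⟨ toℚᵘ-ℕ/ p d ⟩
  ℚᵘ.mkℚᵘ (+ p) d
    ≈⟨ ℚᵘ.*≡* (≡.cong₂ ℤ._*_ (≡.sym (ℤₚ.*-identityʳ (+ p))) (≡.cong (+_ ∘ suc) (ℕₚ.+-identityʳ d))) ⟩
  ℚᵘ.mkℚᵘ (+ p) 0 ℚᵘ.* ℚᵘ.mkℚᵘ (+ 1) d
    ≈⟨ ℚᵘₚ.*-cong (toℚᵘ-ℕ/ p 0) (toℚᵘ-ℕ/ 1 d) ⟨
  ℚ.toℚᵘ (ℕ→ℚ p) ℚᵘ.* ℚ.toℚᵘ (1/ℕ (suc d))
    ≈⟨ ℚₚ.toℚᵘ-homo-* (ℕ→ℚ p) (1/ℕ (suc d)) ⟨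
  ℚ.toℚᵘ (ℕ→ℚ p ℚ.* 1/ℕ (suc d)) ∎)
  where open ℚᵘₚ.≃-Reasoning

q/q≡1 : ∀ q .{{_ : NonZero q}} → (+ q) ℚ./ q ≡ 1ℚ
q/q≡1 (suc d) = ℚₚ.toℚᵘ-injective (ℚᵘₚ.≃-trans (toℚᵘ-ℕ/ (suc d) d)
  (ℚᵘ.*≡* (ℤₚ.*-comm (+ suc d) (+ 1))))

N+j<ᵇN≡false : ∀ N j → ((N ℕ.+ j) <ᵇ N) ≡ false
N+j<ᵇN≡false zero    j = ≡.refl
N+j<ᵇN≡false (suc N) j = N+j<ᵇN≡false N j

n!≡nCk*[k!*[n∸k]!] : ∀ {n k} → k ℕ.≤ n → n ! ≡ (n C k) ℕ.* (k ! ℕ.* (n ∸ k) !)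
n!≡nCk*[k!*[n∸k]!] {n} {k} k≤n = ≡.sym (≡.trans
  (≡.cong (ℕ._* (k ! ℕ.* (n ∸ k) !)) (nCk≡n!/k![n-k]! k≤n))
  (m/n*n≡m {{k !* (n ∸ k) !≢0}} (k![n∸k]!∣n! k≤n)))

module FormalPowerSeries {c ℓ : Level} (R : CommutativeRing c ℓ) where

  open CommutativeRing R
  open import Algebra.Properties.Semiring.Exp semiring using (_^_; ^-homo-*; ^-congʳ)
  open import Algebra.Properties.Monoid.Mult +-monoid using (_×_; ×-homo-+; ×-homo-1; ×-congˡ)
  open import Algebra.Properties.Ring ring using (-1*x≈-x)
  open import Algebra.Properties.Group +-group using (inverseʳ-unique; ⁻¹-involutive)
  open import Algebra.Properties.CommutativeSemigroup +-commutativeSemigroup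
    using () renaming (interchange to +-interchange)
  open import Algebra.Properties.CommutativeSemigroup *-commutativeSemigroup
    using () renaming (interchange to *-interchange)
  open import Relation.Binary.Reasoning.Setoid setoid

  Series : Set c
  Series = ℕ → Carrier

  Σ≤ : ℕ → Series → Carrier
  Σ≤ zero    a = a 0
  Σ≤ (suc n) a = Σ≤ n a + a (suc n)

  Σ≤-cong : ∀ n {a b : Series} → (∀ {i} → i ℕ.≤ n → a i ≈ b i) → Σ≤ n a ≈ Σ≤ n b
  Σ≤-cong zero    a≈b = a≈b z≤n
  Σ≤-cong (suc n) a≈b = +-cong (Σ≤-cong n (a≈b ∘ ℕₚ.m≤n⇒m≤1+n)) (a≈b ℕₚ.≤-refl)

  Σ≤-distrib-+ : ∀ n (a b : Series) → Σ≤ n (λ i → a i + b i) ≈ Σ≤ n a + Σ≤ n b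
  Σ≤-distrib-+ zero    a b = refl
  Σ≤-distrib-+ (suc n) a b = trans (+-congʳ (Σ≤-distrib-+ n a b)) (+-interchange _ _ _ _)

  *-distribˡ-Σ≤ : ∀ n x (a : Series) → x * Σ≤ n a ≈ Σ≤ n (λ i → x * a i)
  *-distribˡ-Σ≤ zero    x a = refl
  *-distribˡ-Σ≤ (suc n) x a = trans (distribˡ x _ _) (+-congʳ (*-distribˡ-Σ≤ n x a))

  Σ≤-unfoldˡ : ∀ n (a : Series) → Σ≤ (suc n) a ≈ a 0 + Σ≤ n (a ∘ suc)
  Σ≤-unfoldˡ zero    a = refl
  Σ≤-unfoldˡ (suc n) a = trans (+-congʳ (Σ≤-unfoldˡ n a)) (+-assoc _ _ _)

  Σ≤-reverse : ∀ n (a : Series) → Σ≤ n a ≈ Σ≤ n (λ i → a (n ∸ i))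
  Σ≤-reverse zero    a = refl
  Σ≤-reverse (suc n) a = trans (+-congʳ (Σ≤-reverse n a))
    (trans (+-comm _ _) (sym (Σ≤-unfoldˡ n (λ i → a (suc n ∸ i)))))

  infixl 7 _⋆_
  _⋆_ : Series → Series → Series
  (a ⋆ b) zero    = a 0 * b 0
  (a ⋆ b) (suc n) = a 0 * b (suc n) + ((a ∘ suc) ⋆ b) n

  ⋆-as-Σ≤ : ∀ n (a b : Series) → (a ⋆ b) n ≈ Σ≤ n (λ i → a i * b (n ∸ i))
  ⋆-as-Σ≤ zero    a b = refl
  ⋆-as-Σ≤ (suc n) a b = trans (+-congˡ (⋆-as-Σ≤ n (a ∘ suc) b))
    (sym (Σ≤-unfoldˡ n (λ i → a i * b (suc n ∸ i))))

  ⋆-cong : ∀ n {a a′ b b′ : Series} →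
           (∀ {i} → i ℕ.≤ n → a i ≈ a′ i) → (∀ {j} → j ℕ.≤ n → b j ≈ b′ j) →
           (a ⋆ b) n ≈ (a′ ⋆ b′) n
  ⋆-cong zero    a≈a′ b≈b′ = *-cong (a≈a′ z≤n) (b≈b′ z≤n)
  ⋆-cong (suc n) a≈a′ b≈b′ = +-cong (*-cong (a≈a′ z≤n) (b≈b′ ℕₚ.≤-refl))
    (⋆-cong n (a≈a′ ∘ s≤s) (b≈b′ ∘ ℕₚ.m≤n⇒m≤1+n))

  ⋆-comm : ∀ n (a b : Series) → (a ⋆ b) n ≈ (b ⋆ a) n
  ⋆-comm n a b = begin
    (a ⋆ b) n                               ≈⟨ ⋆-as-Σ≤ n a b ⟩
    Σ≤ n (λ i → a i * b (n ∸ i))             ≈⟨ Σ≤-reverse n _ ⟩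
    Σ≤ n (λ i → a (n ∸ i) * b (n ∸ (n ∸ i))) ≈⟨ Σ≤-cong n (λ i≤n → trans (*-comm _ _)
                                                 (*-congʳ (reflexive (≡.cong b (ℕₚ.m∸[m∸n]≡n i≤n))))) ⟩
    Σ≤ n (λ i → b i * a (n ∸ i))             ≈⟨ ⋆-as-Σ≤ n b a ⟨
    (b ⋆ a) n                               ∎

  ⋆-distribʳ-+ : ∀ n (a a′ b : Series) → ((λ i → a i + a′ i) ⋆ b) n ≈ (a ⋆ b) n + (a′ ⋆ b) n
  ⋆-distribʳ-+ zero    a a′ b = distribʳ _ _ _
  ⋆-distribʳ-+ (suc n) a a′ b =
    trans (+-cong (distribʳ _ _ _) (⋆-distribʳ-+ n (a ∘ suc) (a′ ∘ suc) b)) (+-interchange _ _ _ _)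

  ⋆-distribˡ-+ : ∀ n (a b b′ : Series) → (a ⋆ (λ i → b i + b′ i)) n ≈ (a ⋆ b) n + (a ⋆ b′) n
  ⋆-distribˡ-+ n a b b′ = trans (⋆-comm n a _)
    (trans (⋆-distribʳ-+ n b b′ a) (+-cong (⋆-comm n b a) (⋆-comm n b′ a)))

  ⋆-scaleˡ : ∀ n x (a b : Series) → ((λ i → x * a i) ⋆ b) n ≈ x * (a ⋆ b) n
  ⋆-scaleˡ zero    x a b = *-assoc _ _ _
  ⋆-scaleˡ (suc n) x a b =
    trans (+-cong (*-assoc _ _ _) (⋆-scaleˡ n x (a ∘ suc) b)) (sym (distribˡ _ _ _))

  ⋆-scaleʳ : ∀ n x (a b : Series) → (a ⋆ (λ i → x * b i)) n ≈ x * (a ⋆ b) n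
  ⋆-scaleʳ n x a b = trans (⋆-comm n a _) (trans (⋆-scaleˡ n x b a) (*-congˡ (⋆-comm n b a)))

  ⋆-negˡ : ∀ n (a b : Series) → ((λ i → - a i) ⋆ b) n ≈ - (a ⋆ b) n
  ⋆-negˡ n a b = begin
    ((λ i → - a i) ⋆ b) n     ≈⟨ ⋆-cong n (λ {i} _ → sym (-1*x≈-x (a i))) (λ _ → refl) ⟩
    ((λ i → - 1# * a i) ⋆ b) n ≈⟨ ⋆-scaleˡ n (- 1#) a b ⟩
    - 1# * (a ⋆ b) n          ≈⟨ -1*x≈-x _ ⟩
    - (a ⋆ b) n               ∎

  ⋆-zeroˡ : ∀ n (b : Series) → ((λ _ → 0#) ⋆ b) n ≈ 0#
  ⋆-zeroˡ zero    b = zeroˡ _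
  ⋆-zeroˡ (suc n) b = trans (+-cong (zeroˡ _) (⋆-zeroˡ n b)) (+-identityˡ 0#)

  ⋆-vanishʳ : ∀ n (a b : Series) → (∀ {j} → j ℕ.≤ n → b j ≈ 0#) → (a ⋆ b) n ≈ 0#
  ⋆-vanishʳ n a b b≈0 = trans (⋆-cong n (λ _ → refl) b≈0) (trans (⋆-comm n a _) (⋆-zeroˡ n a))

  ⋆-distribˡ-Σ≤ : ∀ m n (a : Series) (b : ℕ → Series) →
                  Σ≤ m (λ r → (a ⋆ b r) n) ≈ (a ⋆ (λ k → Σ≤ m (λ r → b r k))) n
  ⋆-distribˡ-Σ≤ zero    n a b = refl
  ⋆-distribˡ-Σ≤ (suc m) n a b =
    trans (+-congʳ (⋆-distribˡ-Σ≤ m n a b)) (sym (⋆-distribˡ-+ n a _ (b (suc m))))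

  ⋆-assoc : ∀ n (a b d : Series) → (a ⋆ (b ⋆ d)) n ≈ ((a ⋆ b) ⋆ d) n
  ⋆-assoc zero    a b d = sym (*-assoc _ _ _)
  ⋆-assoc (suc n) a b d = begin
    a 0 * (b 0 * d (suc n) + ((b ∘ suc) ⋆ d) n) + ((a ∘ suc) ⋆ (b ⋆ d)) n
      ≈⟨ +-cong (distribˡ _ _ _) (⋆-assoc n (a ∘ suc) b d) ⟩
    (a 0 * (b 0 * d (suc n)) + a 0 * ((b ∘ suc) ⋆ d) n) + (((a ∘ suc) ⋆ b) ⋆ d) n
      ≈⟨ +-congʳ (+-cong (sym (*-assoc _ _ _)) (sym (⋆-scaleˡ n (a 0) (b ∘ suc) d))) ⟩
    (a 0 * b 0 * d (suc n) + ((λ i → a 0 * b (suc i)) ⋆ d) n) + (((a ∘ suc) ⋆ b) ⋆ d) n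
      ≈⟨ +-assoc _ _ _ ⟩
    a 0 * b 0 * d (suc n) + (((λ i → a 0 * b (suc i)) ⋆ d) n + (((a ∘ suc) ⋆ b) ⋆ d) n)
      ≈⟨ +-congˡ (sym (⋆-distribʳ-+ n _ _ d)) ⟩
    ((a ⋆ b) ⋆ d) (suc n) ∎

  δ : Series
  δ zero    = 1#
  δ (suc _) = 0#

  ⋆-identityˡ : ∀ n (b : Series) → (δ ⋆ b) n ≈ b n
  ⋆-identityˡ zero    b = *-identityˡ _
  ⋆-identityˡ (suc n) b = trans (+-cong (*-identityˡ _) (⋆-zeroˡ n b)) (+-identityʳ _)

  rescale : Carrier → Series → Series
  rescale φ a j = φ ^ j * a j

  rescale-δ : ∀ φ n → rescale φ δ n ≈ δ n
  rescale-δ φ zero    = *-identityˡ _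
  rescale-δ φ (suc n) = zeroʳ _

  rescale-⋆ : ∀ n φ (a b : Series) → (rescale φ a ⋆ rescale φ b) n ≈ rescale φ (a ⋆ b) n
  rescale-⋆ n φ a b = begin
    (rescale φ a ⋆ rescale φ b) n
      ≈⟨ ⋆-as-Σ≤ n _ _ ⟩
    Σ≤ n (λ i → φ ^ i * a i * (φ ^ (n ∸ i) * b (n ∸ i)))
      ≈⟨ Σ≤-cong n (λ i≤n → trans (*-interchange _ _ _ _) (*-congʳ (φ^i*φ^[n∸i]≈φ^n i≤n))) ⟩
    Σ≤ n (λ i → φ ^ n * (a i * b (n ∸ i)))
      ≈⟨ *-distribˡ-Σ≤ n _ _ ⟨
    φ ^ n * Σ≤ n (λ i → a i * b (n ∸ i))
      ≈⟨ *-congˡ (⋆-as-Σ≤ n a b) ⟨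
    rescale φ (a ⋆ b) n ∎
    where
    φ^i*φ^[n∸i]≈φ^n : ∀ {i} → i ℕ.≤ n → φ ^ i * φ ^ (n ∸ i) ≈ φ ^ n
    φ^i*φ^[n∸i]≈φ^n {i} i≤n = trans (sym (^-homo-* φ i (n ∸ i))) (^-congʳ φ (ℕₚ.m+[n∸m]≡n i≤n))

  infixr 8 _^⋆_
  _^⋆_ : Series → ℕ → Series
  a ^⋆ zero  = δ
  a ^⋆ suc r = a ⋆ a ^⋆ r

  ⋆-distribˡ-Σ≤-^⋆ : ∀ m n (w : ℕ → Carrier) (a : Series) →
                     Σ≤ m (λ r → w r * (a ^⋆ suc r) n) ≈ (a ⋆ (λ k → Σ≤ m (λ r → w r * (a ^⋆ r) k))) n
  ⋆-distribˡ-Σ≤-^⋆ m n w a = trans (Σ≤-cong m (λ {r} _ → sym (⋆-scaleʳ n (w r) a (a ^⋆ r))))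
                                   (⋆-distribˡ-Σ≤ m n a _)

  infix 8 _C#_
  _C#_ : ℕ → ℕ → Carrier
  m C# r = (m C r) × 1#

  C#-pascal : ∀ m r → suc m C# suc r ≈ m C# r + m C# suc r
  C#-pascal m r = trans (×-congˡ (≡.sym (nCk+nC[k+1]≡[n+1]C[k+1] m r))) (×-homo-+ 1# (m C r) (m C suc r))

  C#-zero-* : ∀ m x → m C# 0 * x ≈ x
  C#-zero-* m x = trans (*-congʳ (×-homo-1 1#)) (*-identityˡ x)

  C#-over-* : ∀ m x → m C# suc m * x ≈ 0#
  C#-over-* m x = trans (*-congʳ (×-congˡ (k>n⇒nCk≡0 (ℕₚ.n<1+n m)))) (zeroˡ x)

  -- With h := δ + g, which has no constant term, binomialSum m = h ^⋆ m and, by the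
  -- hockey-stick identity, hockeyStickSum M = Σ_{m≤M} h ^⋆ m. Hence
  -- (δ − h) ⋆ hockeyStickSum M = δ − h ^⋆ (M + 1), which vanishes up to degree M.
  module NegatedInverse (g : Series) (g₀≈-1 : g 0 ≈ - 1#) where

    binomialSum : ℕ → Series
    binomialSum m k = Σ≤ m (λ r → m C# r * (g ^⋆ r) k)

    hockeyStickSum : ℕ → Series
    hockeyStickSum M k = Σ≤ M (λ r → suc M C# suc r * (g ^⋆ r) k)

    binomialSum-unfoldˡ : ∀ m k → binomialSum m k ≈ δ k + Σ≤ m (λ r → m C# suc r * (g ^⋆ suc r) k)
    binomialSum-unfoldˡ m k = begin
      binomialSum m k
        ≈⟨ trans (+-congˡ (C#-over-* m _)) (+-identityʳ _) ⟨
      Σ≤ (suc m) (λ r → m C# r * (g ^⋆ r) k)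
        ≈⟨ Σ≤-unfoldˡ m _ ⟩
      m C# 0 * δ k + Σ≤ m (λ r → m C# suc r * (g ^⋆ suc r) k)
        ≈⟨ +-congʳ (C#-zero-* m _) ⟩
      δ k + Σ≤ m (λ r → m C# suc r * (g ^⋆ suc r) k) ∎

    binomialSum-suc-unfoldˡ : ∀ m k →
      binomialSum (suc m) k ≈ δ k + Σ≤ m (λ r → suc m C# suc r * (g ^⋆ suc r) k)
    binomialSum-suc-unfoldˡ m k = trans (Σ≤-unfoldˡ m _) (+-congʳ (C#-zero-* (suc m) _))

    binomialSum-suc : ∀ m k → binomialSum (suc m) k ≈ binomialSum m k + (g ⋆ binomialSum m) k
    binomialSum-suc m k = begin
      binomialSum (suc m) k
        ≈⟨ binomialSum-suc-unfoldˡ m k ⟩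
      δ k + Σ≤ m (λ r → suc m C# suc r * (g ^⋆ suc r) k)
        ≈⟨ +-congˡ (Σ≤-cong m (λ {r} _ →
             trans (*-congʳ (C#-pascal m r)) (trans (distribʳ _ _ _) (+-comm _ _)))) ⟩
      δ k + Σ≤ m (λ r → m C# suc r * (g ^⋆ suc r) k + m C# r * (g ^⋆ suc r) k)
        ≈⟨ trans (+-congˡ (Σ≤-distrib-+ m _ _)) (sym (+-assoc _ _ _)) ⟩
      (δ k + Σ≤ m (λ r → m C# suc r * (g ^⋆ suc r) k)) + Σ≤ m (λ r → m C# r * (g ^⋆ suc r) k)
        ≈⟨ +-cong (binomialSum-unfoldˡ m k) (sym (⋆-distribˡ-Σ≤-^⋆ m k (m C#_) g)) ⟨
      binomialSum m k + (g ⋆ binomialSum m) k ∎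

    g⋆-vanishing-below : ∀ k (X : Series) → (∀ {j} → j ℕ.< k → X j ≈ 0#) → (g ⋆ X) k ≈ - X k
    g⋆-vanishing-below zero    X X≈0 = trans (*-congʳ g₀≈-1) (-1*x≈-x (X 0))
    g⋆-vanishing-below (suc k) X X≈0 = begin
      g 0 * X (suc k) + ((g ∘ suc) ⋆ X) k ≈⟨ +-congˡ (⋆-vanishʳ k (g ∘ suc) X (X≈0 ∘ s≤s)) ⟩
      g 0 * X (suc k) + 0#               ≈⟨ +-identityʳ _ ⟩
      g 0 * X (suc k)                    ≈⟨ *-congʳ g₀≈-1 ⟩
      - 1# * X (suc k)                   ≈⟨ -1*x≈-x _ ⟩
      - X (suc k)                        ∎

    binomialSum-vanishes : ∀ m k → k ℕ.< m → binomialSum m k ≈ 0#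
    binomialSum-vanishes (suc m) k (s≤s k≤m) = begin
      binomialSum (suc m) k                   ≈⟨ binomialSum-suc m k ⟩
      binomialSum m k + (g ⋆ binomialSum m) k ≈⟨ +-congˡ (g⋆-vanishing-below k _ binomialSum-m-vanishes) ⟩
      binomialSum m k - binomialSum m k       ≈⟨ -‿inverseʳ _ ⟩
      0#                                      ∎
      where
      binomialSum-m-vanishes : ∀ {j} → j ℕ.< k → binomialSum m j ≈ 0#
      binomialSum-m-vanishes j<k = binomialSum-vanishes m _ (ℕₚ.<-≤-trans {j = k} j<k k≤m)

    hockeyStickSum-suc : ∀ M k → hockeyStickSum (suc M) k ≈ hockeyStickSum M k + binomialSum (suc M) k
    hockeyStickSum-suc M k = begin
      hockeyStickSum (suc M) k
        ≈⟨ Σ≤-cong (suc M) (λ {r} _ → trans (*-congʳ (C#-pascal (suc M) r)) (distribʳ _ _ _)) ⟩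
      Σ≤ (suc M) (λ r → suc M C# r * (g ^⋆ r) k + suc M C# suc r * (g ^⋆ r) k)
        ≈⟨ Σ≤-distrib-+ (suc M) _ _ ⟩
      binomialSum (suc M) k + (hockeyStickSum M k + suc M C# suc (suc M) * (g ^⋆ suc M) k)
        ≈⟨ +-congˡ (trans (+-congˡ (C#-over-* (suc M) _)) (+-identityʳ _)) ⟩
      binomialSum (suc M) k + hockeyStickSum M k
        ≈⟨ +-comm _ _ ⟩
      hockeyStickSum M k + binomialSum (suc M) k ∎

    hockeyStickSum-stable : ∀ d k → hockeyStickSum (k ℕ.+ d) k ≈ hockeyStickSum k k
    hockeyStickSum-stable zero    k rewrite ℕₚ.+-identityʳ k = refl
    hockeyStickSum-stable (suc d) k rewrite ℕₚ.+-suc k d = begin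
      hockeyStickSum (suc (k ℕ.+ d)) k
        ≈⟨ hockeyStickSum-suc (k ℕ.+ d) k ⟩
      hockeyStickSum (k ℕ.+ d) k + binomialSum (suc (k ℕ.+ d)) k
        ≈⟨ +-cong (hockeyStickSum-stable d k) (binomialSum-vanishes _ k (s≤s (ℕₚ.m≤m+n k d))) ⟩
      hockeyStickSum k k + 0#
        ≈⟨ +-identityʳ _ ⟩
      hockeyStickSum k k ∎

    δ+g⋆hockeyStickSum : ∀ M k → δ k + (g ⋆ hockeyStickSum M) k ≈ binomialSum (suc M) k
    δ+g⋆hockeyStickSum M k = trans (+-congˡ (sym (⋆-distribˡ-Σ≤-^⋆ M k (λ r → suc M C# suc r) g)))
                                   (sym (binomialSum-suc-unfoldˡ M k))

    -g⋆hockeyStickSum-diagonal : ∀ p → ((λ j → - g j) ⋆ (λ k → hockeyStickSum k k)) p ≈ δ p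
    -g⋆hockeyStickSum-diagonal p = begin
      ((λ j → - g j) ⋆ (λ k → hockeyStickSum k k)) p
        ≈⟨ ⋆-cong p (λ _ → refl) diagonal≈row ⟩
      ((λ j → - g j) ⋆ hockeyStickSum p) p
        ≈⟨ ⋆-negˡ p g _ ⟩
      - (g ⋆ hockeyStickSum p) p
        ≈⟨ -‿cong (inverseʳ-unique (δ p) _ δ+g⋆hockeyStickSum≈0) ⟩
      - - δ p
        ≈⟨ ⁻¹-involutive (δ p) ⟩
      δ p ∎
      where
      diagonal≈row : ∀ {j} → j ℕ.≤ p → hockeyStickSum j j ≈ hockeyStickSum p j
      diagonal≈row {j} j≤p = trans (sym (hockeyStickSum-stable (p ∸ j) j))
        (reflexive (≡.cong (λ M → hockeyStickSum M j) (ℕₚ.m+[n∸m]≡n j≤p)))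
      δ+g⋆hockeyStickSum≈0 : δ p + (g ⋆ hockeyStickSum p) p ≈ 0#
      δ+g⋆hockeyStickSum≈0 = trans (δ+g⋆hockeyStickSum p p) (binomialSum-vanishes (suc p) p (ℕₚ.n<1+n p))

module HypergeometricBernoulli {c ℓ : Level} (R : CommutativeRing c ℓ)
       (ι : ℚ → CommutativeRing.Carrier R)
       (ι-hom : IsRingHomomorphism (CommutativeRing.rawRing ℚring) (CommutativeRing.rawRing R) ι)
       where

  open CommutativeRing R
  open Over R ι
  open FormalPowerSeries R
  open IsRingHomomorphism ι-hom
  open import Algebra.Properties.Semiring.Exp semiring using (_^_)
  open import Algebra.Properties.Monoid.Mult +-monoid using (_×_)
  open import Algebra.Properties.Semiring.Mult semiring using (×1-homo-*)
  open import Algebra.Properties.Ring ring using (-‿distribˡ-*)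
  open import Algebra.Properties.Group +-group using (⁻¹-involutive)
  open import Algebra.Properties.AbelianGroup +-abelianGroup using (xyx⁻¹≈y)
  open import Algebra.Properties.CommutativeSemigroup *-commutativeSemigroup
    using () renaming (interchange to *-interchange; x∙yz≈y∙xz to x*[y*z]≈y*[x*z])
  open import Algebra.Solver.Ring.NaturalCoefficients.Default commutativeSemiring
    using (solve; _:=_; _:*_)
  open import Relation.Binary.Reasoning.Setoid setoid

  ⟨⟩≈×1# : ∀ m → ⟨ m ⟩ ≈ m × 1#
  ⟨⟩≈×1# zero    = 0#-homo
  ⟨⟩≈×1# (suc m) = trans (⟦⟧-cong (ℕ→ℚ-homo-+ 1 m)) (trans (+-homo _ _) (+-cong 1#-homo (⟨⟩≈×1# m)))

  ⟨⟩-homo-* : ∀ m n → ⟨ m ℕ.* n ⟩ ≈ ⟨ m ⟩ * ⟨ n ⟩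
  ⟨⟩-homo-* m n = trans (⟨⟩≈×1# (m ℕ.* n))
    (trans (×1-homo-* m n) (sym (*-cong (⟨⟩≈×1# m) (⟨⟩≈×1# n))))

  ⟨⟩-homo-^ : ∀ m j → ⟨ m ℕ.^ j ⟩ ≈ ⟨ m ⟩ ^ j
  ⟨⟩-homo-^ m zero    = 1#-homo
  ⟨⟩-homo-^ m (suc j) = trans (⟨⟩-homo-* m (m ℕ.^ j)) (*-congˡ (⟨⟩-homo-^ m j))

  ι-p/q : ∀ p q .{{_ : NonZero q}} → ι ((+ p) ℚ./ q) ≈ ⟨ p ⟩ * ι (1/ℕ q)
  ι-p/q p q = trans (⟦⟧-cong (p/q≡p*1/q p q)) (*-homo _ _)

  ⟨q⟩*ι[1/q]≈1 : ∀ q .{{_ : NonZero q}} → ⟨ q ⟩ * ι (1/ℕ q) ≈ 1#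
  ⟨q⟩*ι[1/q]≈1 q = trans (sym (ι-p/q q q)) (trans (⟦⟧-cong (q/q≡1 q)) 1#-homo)

  ⟨n!⟩*ι[1/n!]≈1 : ∀ n → ⟨ n ! ⟩ * ι (inv! n) ≈ 1#
  ⟨n!⟩*ι[1/n!]≈1 n = ⟨q⟩*ι[1/q]≈1 (n !) {{n !≢0}}

  ι-sumℚ≤ : ∀ k (G : ℕ → ℚ) → ι (sumℚ≤ k G) ≈ Σ≤ k (ι ∘ G)
  ι-sumℚ≤ zero    G = refl
  ι-sumℚ≤ (suc k) G = trans (+-homo _ _) (+-congʳ (ι-sumℚ≤ k G))

  sum≤≈Σ≤ : ∀ n a → sum≤ n a ≈ Σ≤ n a
  sum≤≈Σ≤ zero    a = refl
  sum≤≈Σ≤ (suc n) a = +-congʳ (sum≤≈Σ≤ n a)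

  sum1-*ˡ : ∀ F (χ : ℕ → Carrier) x (y : ℕ → Carrier) →
            sum1 F (λ a → χ a * (x * y a)) ≈ x * sum1 F (λ a → χ a * y a)
  sum1-*ˡ zero    χ x y = sym (zeroʳ x)
  sum1-*ˡ (suc F) χ x y = trans (+-cong (sum1-*ˡ F χ x y) (x*[y*z]≈y*[x*z] _ _ _)) (sym (distribˡ _ _ _))

  module _ (N : ℕ) where

    g : Series
    g j = ι (ℚ.- ℕ→ℚ (N !) ℚ.* inv! (N ℕ.+ j))

    -g≈N!/[N+j]! : ∀ j → - g j ≈ ⟨ N ! ⟩ * ι (inv! (N ℕ.+ j))
    -g≈N!/[N+j]! j = begin
      - ι (ℚ.- ℕ→ℚ (N !) ℚ.* inv! (N ℕ.+ j))   ≈⟨ -‿cong (trans (*-homo _ _) (*-congʳ (-‿homo _))) ⟩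
      - (- ⟨ N ! ⟩ * ι (inv! (N ℕ.+ j)))      ≈⟨ -‿cong (-‿distribˡ-* _ _) ⟨
      - - (⟨ N ! ⟩ * ι (inv! (N ℕ.+ j)))      ≈⟨ ⁻¹-involutive _ ⟩
      ⟨ N ! ⟩ * ι (inv! (N ℕ.+ j))            ∎

    g₀≈-1 : g 0 ≈ - 1#
    g₀≈-1 = begin
      g 0                                ≈⟨ ⁻¹-involutive _ ⟨
      - - g 0                            ≈⟨ -‿cong (-g≈N!/[N+j]! 0) ⟩
      - (⟨ N ! ⟩ * ι (inv! (N ℕ.+ 0)))    ≈⟨ -‿cong (*-congˡ (⟦⟧-cong (≡.cong inv! (ℕₚ.+-identityʳ N)))) ⟩
      - (⟨ N ! ⟩ * ι (inv! N))            ≈⟨ -‿cong (⟨n!⟩*ι[1/n!]≈1 N) ⟩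
      - 1#                               ∎

    ι-Ttilde : ∀ r k → ι (Ttilde N r k) ≈ (g ^⋆ r) k
    ι-Ttilde zero zero    = trans (*-homo _ _) (trans (*-cong 1#-homo 1#-homo) (*-identityˡ _))
    ι-Ttilde zero (suc k) = trans (*-homo _ _) (trans (*-cong 1#-homo 0#-homo) (zeroʳ _))
    ι-Ttilde (suc r) k = begin
      ι (X ℚ.* powℚ X r ℚ.* sumℚ≤ k (λ i → inv! (N ℕ.+ i) ℚ.* W N r (k ∸ i)))
        ≈⟨ trans (*-homo _ _) (*-cong (*-homo _ _) (ι-sumℚ≤ k _)) ⟩
      ι X * ι (powℚ X r) * Σ≤ k (λ i → ι (inv! (N ℕ.+ i) ℚ.* W N r (k ∸ i)))
        ≈⟨ *-distribˡ-Σ≤ k _ _ ⟩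
      Σ≤ k (λ i → ι X * ι (powℚ X r) * ι (inv! (N ℕ.+ i) ℚ.* W N r (k ∸ i)))
        ≈⟨ Σ≤-cong k (λ {i} _ → ι-summand i) ⟩
      Σ≤ k (λ i → g i * (g ^⋆ r) (k ∸ i))
        ≈⟨ ⋆-as-Σ≤ k g (g ^⋆ r) ⟨
      (g ^⋆ suc r) k ∎
      where
      X = ℚ.- ℕ→ℚ (N !)
      ι-summand : ∀ i → ι X * ι (powℚ X r) * ι (inv! (N ℕ.+ i) ℚ.* W N r (k ∸ i)) ≈ g i * (g ^⋆ r) (k ∸ i)
      ι-summand i = begin
        ι X * ι (powℚ X r) * ι (inv! (N ℕ.+ i) ℚ.* W N r (k ∸ i))
          ≈⟨ *-congˡ (*-homo _ _) ⟩
        ι X * ι (powℚ X r) * (ι (inv! (N ℕ.+ i)) * ι (W N r (k ∸ i)))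
          ≈⟨ *-interchange _ _ _ _ ⟩
        ι X * ι (inv! (N ℕ.+ i)) * (ι (powℚ X r) * ι (W N r (k ∸ i)))
          ≈⟨ *-cong (sym (*-homo _ _)) (trans (sym (*-homo _ _)) (ι-Ttilde r (k ∸ i))) ⟩
        g i * (g ^⋆ r) (k ∸ i) ∎

    open NegatedInverse g g₀≈-1 public

    ι-hockeyStickSum : ∀ k →
      ι (sumℚ≤ k (λ r → ℕ→ℚ (suc k C suc r) ℚ.* Ttilde N r k)) ≈ hockeyStickSum k k
    ι-hockeyStickSum k = trans (ι-sumℚ≤ k _)
      (Σ≤-cong k (λ {r} _ → trans (*-homo _ _) (*-cong (⟨⟩≈×1# (suc k C suc r)) (ι-Ttilde r k))))

  module Coefficients (N f : ℕ) .{{_ : NonZero f}} (χ : ℕ → Carrier) (base : ℕ → Carrier) where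

    -- s is S (base a = a) or S(x) (base a = x + a). The denominator of the generating function
    -- is t^N · shiftedDen and its numerator t^N · expSum / N!.
    open GF N f χ base

    instance
      f^N≢0 : NonZero (f ℕ.^ N)
      f^N≢0 = m^n≢0 f N

    s : ℕ → Carrier
    s m = sum1 f (λ a → χ a * pow (base a) m)

    expSum : Series
    expSum m = ι (inv! m) * s m

    shiftedDen : Series
    shiftedDen j = ι (den (N ℕ.+ j))

    reciprocal : Series
    reciprocal k = ι (1/ℕ (f ℕ.^ N)) * rescale ⟨ f ⟩ (λ m → hockeyStickSum N m m) k

    quotient : Series
    quotient = reciprocal ⋆ expSum

    num-shift : ∀ n → num (N ℕ.+ n) ≈ ι (inv! N) * expSum n
    num-shift n = begin
      num (N ℕ.+ n)
        ≈⟨ reflexive (≡.cong (λ b → if b then 0# else numerator (N ℕ.+ n ∸ N)) (N+j<ᵇN≡false N n)) ⟩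
      numerator (N ℕ.+ n ∸ N)
        ≈⟨ reflexive (≡.cong numerator (ℕₚ.m+n∸m≡n N n)) ⟩
      numerator n
        ≈⟨ trans (sum1-*ˡ f χ _ _) (*-congˡ (sum1-*ˡ f χ _ _)) ⟩
      ι (inv! N) * expSum n ∎
      where
      numerator : ℕ → Carrier
      numerator m = sum1 f (λ a → χ a * (ι (inv! N) * (ι (inv! m) * pow (base a) m)))

    den-shift : ∀ j → den (N ℕ.+ j) ≡ ℕ→ℚ (f ℕ.^ (N ℕ.+ j)) ℚ.* inv! (N ℕ.+ j)
    den-shift j =
      ≡.trans (≡.cong (λ b → F ℚ.- (if b then F else 0ℚ)) (N+j<ᵇN≡false N j)) (ℚₚ.+-identityʳ F)
      where F = ℕ→ℚ (f ℕ.^ (N ℕ.+ j)) ℚ.* inv! (N ℕ.+ j)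

    shiftedDen-factor : ∀ j →
      shiftedDen j ≈ (⟨ f ℕ.^ N ⟩ * ι (inv! N)) * rescale ⟨ f ⟩ (λ i → - g N i) j
    shiftedDen-factor j = begin
      ι (den (N ℕ.+ j))
        ≈⟨ trans (⟦⟧-cong (den-shift j)) (*-homo _ _) ⟩
      F′ * J
        ≈⟨ *-congʳ (trans (reflexive (≡.cong ⟨_⟩ (ℕₚ.^-distribˡ-+-* f N j)))
                          (trans (⟨⟩-homo-* (f ℕ.^ N) (f ℕ.^ j)) (*-congˡ (⟨⟩-homo-^ f j)))) ⟩
      F * P * J
        ≈⟨ trans (*-congˡ (⟨n!⟩*ι[1/n!]≈1 N)) (*-identityʳ _) ⟨
      F * P * J * (M * ι (inv! N))
        ≈⟨ solve 5 (λ F P J M I → F :* P :* J :* (M :* I) := F :* I :* (P :* (M :* J))) refl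
                 F P J M (ι (inv! N)) ⟩
      F * ι (inv! N) * (P * (M * J))
        ≈⟨ *-congˡ (*-congˡ (-g≈N!/[N+j]! N j)) ⟨
      F * ι (inv! N) * (P * - g N j) ∎
      where
      F′ = ⟨ f ℕ.^ (N ℕ.+ j) ⟩
      F = ⟨ f ℕ.^ N ⟩
      P = ⟨ f ⟩ ^ j
      M = ⟨ N ! ⟩
      J = ι (inv! (N ℕ.+ j))

    shiftedDen⋆reciprocal : ∀ n → (shiftedDen ⋆ reciprocal) n ≈ ι (inv! N) * δ n
    shiftedDen⋆reciprocal n = begin
      (shiftedDen ⋆ reciprocal) n
        ≈⟨ ⋆-cong n (λ {j} _ → shiftedDen-factor j) (λ _ → refl) ⟩
      ((λ j → α * rescale ⟨ f ⟩ (λ i → - g N i) j) ⋆ (λ k → β * rescale ⟨ f ⟩ H k)) n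
        ≈⟨ trans (⋆-scaleˡ n α _ _) (*-congˡ (⋆-scaleʳ n β _ _)) ⟩
      α * (β * (rescale ⟨ f ⟩ (λ i → - g N i) ⋆ rescale ⟨ f ⟩ H) n)
        ≈⟨ *-congˡ (*-congˡ (rescale-⋆ n ⟨ f ⟩ _ H)) ⟩
      α * (β * (⟨ f ⟩ ^ n * ((λ i → - g N i) ⋆ H) n))
        ≈⟨ *-congˡ (*-congˡ (trans (*-congˡ (-g⋆hockeyStickSum-diagonal N n)) (rescale-δ ⟨ f ⟩ n))) ⟩
      α * (β * δ n)
        ≈⟨ *-assoc _ _ _ ⟨
      α * β * δ n
        ≈⟨ *-congʳ α*β≈1/N! ⟩
      ι (inv! N) * δ n ∎
      where
      α = ⟨ f ℕ.^ N ⟩ * ι (inv! N)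
      β = ι (1/ℕ (f ℕ.^ N))
      H = λ k → hockeyStickSum N k k
      α*β≈1/N! : α * β ≈ ι (inv! N)
      α*β≈1/N! = trans (*-assoc _ _ _) (trans (*-congˡ (*-comm _ _))
        (trans (sym (*-assoc _ _ _)) (trans (*-congʳ (⟨q⟩*ι[1/q]≈1 (f ℕ.^ N))) (*-identityˡ _))))

    quotient-solves : ∀ n → Σ≤ n (λ i → ι (den (N ℕ.+ n ∸ i)) * quotient i) ≈ num (N ℕ.+ n)
    quotient-solves n = begin
      Σ≤ n (λ i → ι (den (N ℕ.+ n ∸ i)) * quotient i)
        ≈⟨ Σ≤-cong n (λ {i} i≤n → trans (*-comm _ _)
             (*-congˡ (⟦⟧-cong (≡.cong den (ℕₚ.+-∸-assoc N i≤n))))) ⟩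
      Σ≤ n (λ i → quotient i * shiftedDen (n ∸ i))
        ≈⟨ ⋆-as-Σ≤ n quotient shiftedDen ⟨
      (quotient ⋆ shiftedDen) n
        ≈⟨ trans (⋆-comm n quotient shiftedDen) (⋆-assoc n shiftedDen reciprocal expSum) ⟩
      ((shiftedDen ⋆ reciprocal) ⋆ expSum) n
        ≈⟨ ⋆-cong n (λ {p} _ → shiftedDen⋆reciprocal p) (λ _ → refl) ⟩
      ((λ p → ι (inv! N) * δ p) ⋆ expSum) n
        ≈⟨ trans (⋆-scaleˡ n _ δ expSum) (*-congˡ (⋆-identityˡ n expSum)) ⟩
      ι (inv! N) * expSum n
        ≈⟨ num-shift n ⟨
      num (N ℕ.+ n) ∎

    ι-den-∸-cong : ∀ n {a b} → a ≡ b → ι (den (N ℕ.+ n ∸ a)) ≈ ι (den (N ℕ.+ n ∸ b))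
    ι-den-∸-cong n a≡b = ⟦⟧-cong (≡.cong (λ t → den (N ℕ.+ n ∸ t)) a≡b)

    conv-++ : ∀ n i xs y →
              conv n i (xs ++ [ y ]) ≈ conv n i xs + ι (den (N ℕ.+ n ∸ (i ℕ.+ length xs))) * y
    conv-++ n i []       y = begin
      ι (den (N ℕ.+ n ∸ i)) * y + 0#           ≈⟨ +-identityʳ _ ⟩
      ι (den (N ℕ.+ n ∸ i)) * y                ≈⟨ *-congʳ (ι-den-∸-cong n (≡.sym (ℕₚ.+-identityʳ i))) ⟩
      ι (den (N ℕ.+ n ∸ (i ℕ.+ 0))) * y        ≈⟨ +-identityˡ _ ⟨
      0# + ι (den (N ℕ.+ n ∸ (i ℕ.+ 0))) * y   ∎
    conv-++ n i (x ∷ xs) y = begin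
      ι (den (N ℕ.+ n ∸ i)) * x + conv n (suc i) (xs ++ [ y ])
        ≈⟨ +-congˡ (conv-++ n (suc i) xs y) ⟩
      ι (den (N ℕ.+ n ∸ i)) * x + (conv n (suc i) xs + ι (den (N ℕ.+ n ∸ (suc i ℕ.+ length xs))) * y)
        ≈⟨ +-assoc _ _ _ ⟨
      conv n i (x ∷ xs) + ι (den (N ℕ.+ n ∸ (suc i ℕ.+ length xs))) * y
        ≈⟨ +-congˡ (*-congʳ (ι-den-∸-cong n (≡.sym (ℕₚ.+-suc i (length xs))))) ⟩
      conv n i (x ∷ xs) + ι (den (N ℕ.+ n ∸ (i ℕ.+ length (x ∷ xs)))) * y ∎

    length-prefix : ∀ m → length (prefix m) ≡ m
    length-prefix zero    = ≡.refl
    length-prefix (suc m) =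
      ≡.trans (length-++ (prefix m)) (≡.trans (≡.cong (ℕ._+ 1) (length-prefix m)) (ℕₚ.+-comm m 1))

    conv-prefix : ∀ n m (u : Series) → (∀ {i} → i ℕ.< m → coeff i ≈ u i) →
                  conv n 0 (prefix m) + ι (den (N ℕ.+ n ∸ m)) * u m
                  ≈ Σ≤ m (λ i → ι (den (N ℕ.+ n ∸ i)) * u i)
    conv-prefix n zero    u coeff≈u = +-identityˡ _
    conv-prefix n (suc m) u coeff≈u = +-congʳ (begin
      conv n 0 (prefix m ++ [ coeff m ])
        ≈⟨ conv-++ n 0 (prefix m) (coeff m) ⟩
      conv n 0 (prefix m) + ι (den (N ℕ.+ n ∸ length (prefix m))) * coeff m
        ≈⟨ +-congˡ (*-cong (ι-den-∸-cong n (length-prefix m)) (coeff≈u (ℕₚ.n<1+n m))) ⟩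
      conv n 0 (prefix m) + ι (den (N ℕ.+ n ∸ m)) * u m
        ≈⟨ conv-prefix n m u (coeff≈u ∘ ℕₚ.m<n⇒m<1+n) ⟩
      Σ≤ m (λ i → ι (den (N ℕ.+ n ∸ i)) * u i) ∎)

    invLead*den≈1 : ι invLead * ι (den N) ≈ 1#
    invLead*den≈1 = begin
      ι invLead * ι (den N)
        ≈⟨ *-cong (ι-p/q (N !) (f ℕ.^ N)) (trans (⟦⟧-cong den-leading) (*-homo _ _)) ⟩
      ⟨ N ! ⟩ * ι (1/ℕ (f ℕ.^ N)) * (⟨ f ℕ.^ N ⟩ * ι (inv! N))
        ≈⟨ solve 4 (λ a b c d → a :* b :* (c :* d) := a :* d :* (c :* b)) refl _ _ _ _ ⟩
      ⟨ N ! ⟩ * ι (inv! N) * (⟨ f ℕ.^ N ⟩ * ι (1/ℕ (f ℕ.^ N)))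
        ≈⟨ trans (*-cong (⟨n!⟩*ι[1/n!]≈1 N) (⟨q⟩*ι[1/q]≈1 (f ℕ.^ N))) (*-identityˡ 1#) ⟩
      1# ∎
      where
      den-leading : den N ≡ ℕ→ℚ (f ℕ.^ N) ℚ.* inv! N
      den-leading = ≡.subst (λ m → den m ≡ ℕ→ℚ (f ℕ.^ m) ℚ.* inv! m) (ℕₚ.+-identityʳ N) (den-shift 0)

    coeff≈quotient : ∀ n → coeff n ≈ quotient n
    coeff≈quotient = <-rec (λ n → coeff n ≈ quotient n) coeff≈quotient-from-below
      where
      coeff≈quotient-from-below : ∀ n → (∀ {i} → i ℕ.< n → coeff i ≈ quotient i) → coeff n ≈ quotient n
      coeff≈quotient-from-below n coeff≈quotient-below = begin
        ι invLead * (num (N ℕ.+ n) - conv n 0 (prefix n))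
          ≈⟨ *-congˡ (+-congʳ (trans (sym (quotient-solves n))
                                     (sym (conv-prefix n n quotient coeff≈quotient-below)))) ⟩
        ι invLead * (conv n 0 (prefix n) + ι (den (N ℕ.+ n ∸ n)) * quotient n - conv n 0 (prefix n))
          ≈⟨ *-congˡ (xyx⁻¹≈y _ _) ⟩
        ι invLead * (ι (den (N ℕ.+ n ∸ n)) * quotient n)
          ≈⟨ *-assoc _ _ _ ⟨
        ι invLead * ι (den (N ℕ.+ n ∸ n)) * quotient n
          ≈⟨ *-congʳ (trans (*-congˡ (⟦⟧-cong (≡.cong den (ℕₚ.m+n∸n≡m N n)))) invLead*den≈1) ⟩
        1# * quotient n
          ≈⟨ *-identityˡ _ ⟩
        quotient n ∎

    ι-coefRHS : ∀ {n k} → k ℕ.≤ n → ι (coefRHS N f n k) ≈ ⟨ n ! ⟩ * (reciprocal k * ι (inv! (n ∸ k)))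
    ι-coefRHS {n} {k} k≤n = begin
      ι (coefRHS N f n k)
        ≈⟨ trans (*-homo _ _) (*-congˡ (*-homo _ _)) ⟩
      ι ((+ (k ! ℕ.* f ℕ.^ k)) ℚ./ (f ℕ.^ N))
        * (Γ * ι (sumℚ≤ k (λ r → ℕ→ℚ (suc k C suc r) ℚ.* Ttilde N r k)))
        ≈⟨ *-cong (trans (ι-p/q (k ! ℕ.* f ℕ.^ k) (f ℕ.^ N))
                         (*-congʳ (trans (⟨⟩-homo-* (k !) (f ℕ.^ k)) (*-congˡ (⟨⟩-homo-^ f k)))))
                  (*-congˡ (ι-hockeyStickSum N k)) ⟩
      K * P * β * (Γ * H)
        ≈⟨ trans (*-congˡ (⟨q⟩*ι[1/q]≈1 ((n ∸ k) !) {{(n ∸ k) !≢0}})) (*-identityʳ _) ⟨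
      K * P * β * (Γ * H) * (M * V)
        ≈⟨ solve 7 (λ K P β Γ H M V → K :* P :* β :* (Γ :* H) :* (M :* V)
                                    := Γ :* (K :* M) :* (β :* (P :* H) :* V))
                 refl K P β Γ H M V ⟩
      Γ * (K * M) * (β * (P * H) * V)
        ≈⟨ *-congʳ n!≈Γ*[K*M] ⟨
      ⟨ n ! ⟩ * (reciprocal k * V) ∎
      where
      Γ = ⟨ n C k ⟩
      K = ⟨ k ! ⟩
      M = ⟨ (n ∸ k) ! ⟩
      P = ⟨ f ⟩ ^ k
      H = hockeyStickSum N k k
      V = ι (inv! (n ∸ k))
      β = ι (1/ℕ (f ℕ.^ N))
      n!≈Γ*[K*M] : ⟨ n ! ⟩ ≈ Γ * (K * M)
      n!≈Γ*[K*M] = trans (reflexive (≡.cong ⟨_⟩ (n!≡nCk*[k!*[n∸k]!] k≤n)))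
                         (trans (⟨⟩-homo-* (n C k) _) (*-congˡ (⟨⟩-homo-* (k !) ((n ∸ k) !))))

    closed-form : ∀ n → ⟨ n ! ⟩ * coeff n ≈ sum≤ n (λ k → ι (coefRHS N f n k) * s (n ∸ k))
    closed-form n = begin
      ⟨ n ! ⟩ * coeff n
        ≈⟨ *-congˡ (trans (coeff≈quotient n) (⋆-as-Σ≤ n reciprocal expSum)) ⟩
      ⟨ n ! ⟩ * Σ≤ n (λ k → reciprocal k * expSum (n ∸ k))
        ≈⟨ *-distribˡ-Σ≤ n _ _ ⟩
      Σ≤ n (λ k → ⟨ n ! ⟩ * (reciprocal k * (ι (inv! (n ∸ k)) * s (n ∸ k))))
        ≈⟨ Σ≤-cong n (λ k≤n → trans (trans (*-congˡ (sym (*-assoc _ _ _))) (sym (*-assoc _ _ _)))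
                                    (*-congʳ (sym (ι-coefRHS k≤n)))) ⟩
      Σ≤ n (λ k → ι (coefRHS N f n k) * s (n ∸ k))
        ≈⟨ sum≤≈Σ≤ n _ ⟨
      sum≤ n (λ k → ι (coefRHS N f n k) * s (n ∸ k)) ∎

open import Data.Product using (_×_; _,_)

theorem5p2 : {c ℓ : Level} (R : CommutativeRing c ℓ)
    (ι : ℚ → CommutativeRing.Carrier R)
    → IsRingHomomorphism (CommutativeRing.rawRing ℚring) (CommutativeRing.rawRing R) ι
    → (N : ℕ) → N ≥ 1
    → (f : ℕ) .{{_ : NonZero f}}
    → (χ : ℕ → CommutativeRing.Carrier R) → Over.HasConductor R ι f χ
    → (n : ℕ) → n ≥ 1
    → (x : CommutativeRing.Carrier R)
    → CommutativeRing._≈_ R (Over.B R ι N f χ n) (Over.RHS R ι N f (Over.S R ι f χ) n)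
    × CommutativeRing._≈_ R (Over.Bx R ι N f χ x n) (Over.RHS R ι N f (Over.Sx R ι f χ x) n)
theorem5p2 R ι ι-hom N _ f χ _ n _ x =
  Coefficients.closed-form N f χ (λ a → ⟨ a ⟩) n ,
  Coefficients.closed-form N f χ (λ a → x + ⟨ a ⟩) n
  where
  open CommutativeRing R using (_+_)
  open Over R ι using (⟨_⟩)
  open HypergeometricBernoulli R ι ι-hom
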